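{- Let $n\ge1$ and let $\mathrm{id}=12\cdots n$. Then $$\sum_{\sigma\in[R(\mathrm{id}),\mathrm{id}]}(-1)^{|\sigma|}(-1)^{g(\sigma)}=(-1)^n b_n,$$ where $b_1=1$ and $b_n=2$ for $n\ge2$.
   Context: $[R(\mathrm{id}),\mathrm{id}]$ is the set of ordered partitions $\sigma=(C_1,\dots,C_k)$ of $[n]$ whose blocks are consecutive integer intervals appearing in increasing order. That is, $C_i=\{c_1+\cdots+c_{i-1}+1,\dots,c_1+\cdots+c_i\}$ for some composition $(c_1,\dots,c_k)$ of $n$. Here $|\sigma|=k$. $g(\sigma)$ is the permutation obtained by writing each block in decreasing order and reading the blocks left to right. $(-1)^\tau$ is the sign of a permutation. -}

module Defs where

open import Data.Nat using (ℕ; zero; suc; _+_; _<ᵇ_; _≡ᵇ_)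
open import Data.Nat.Properties using (_≟_; _<?_)
open import Data.Bool using (Bool; true; false; if_then_else_)
open import Data.Nat.ListAction using (sum)
open import Data.List using (List; []; _∷_; map; concatMap; filter; length; reverse; upTo; _++_; foldr)
open import Data.Integer as ℤ using (ℤ; 1ℤ)
open import Relation.Nullary.Decidable using (⌊_⌋)

oneTo : ℕ → List ℕ
oneTo m = map suc (upTo m)

listsOf : List ℕ → ℕ → List (List ℕ)
listsOf xs zero = [] ∷ []
listsOf xs (suc k) = concatMap (λ x → map (λ l → x ∷ l) (listsOf xs k)) xs

-- Compositions of n: lists (c₁,…,c_k) of positive integers with sum n.
-- (Each part is in 1..n and k ≤ n; this enumerates every composition exactly once.)
-- A composition encodes the ordered partition σ = (C₁,…,C_k) of [n] into consecutive
-- intervals C_i = {c₁+…+c_{i-1}+1, …, c₁+…+c_i}; this is a bijection with [R(id),id].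
compositions : ℕ → List (List ℕ)
compositions n = filter (λ cs → sum cs ≟ n) (concatMap (listsOf (oneTo n)) (upTo (suc n)))

decBlock : ℕ → ℕ → List ℕ
decBlock s c = reverse (map (λ i → s + i) (oneTo c))

-- g(σ): each block C_i written in decreasing order, blocks read left to right
-- (one-line notation of a permutation of [n]); first argument = offset.
gAux : ℕ → List ℕ → List ℕ
gAux s [] = []
gAux s (c ∷ cs) = decBlock s c ++ gAux (s + c) cs

g : List ℕ → List ℕ
g = gAux 0

inversions : List ℕ → ℕ
inversions [] = 0
inversions (x ∷ xs) = length (filter (λ y → y <? x) xs) + inversions xs

signPow : ℕ → ℤ
signPow zero = 1ℤ
signPow (suc k) = ℤ.- signPow k

sign : List ℕ → ℤ
sign w = signPow (inversions w)

sumℤ : List ℤ → ℤ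
sumℤ = foldr ℤ._+_ (ℤ.+ 0)

b : ℕ → ℕ
b 1 = 1
b _ = 2

-- Encode σ by its composition (c₁,…,c_k). The word g(σ) is a
-- concatenation of decreasing blocks, every entry of a block being smaller
-- than all later entries, so its inversions are exactly the inversions inside
-- the blocks: inv(g σ) = Σ c_i(c_i-1)/2. Hence the summand is multiplicative,
--   (-1)^{|σ|} (-1)^{g σ} = Π w(c_i),   w(c) = -(-1)^{c(c-1)/2},
-- and w(c+2) = -w(c). Grouping words by their first letter shows that the
-- total F(m) over compositions of m obeys the convolution recurrence
--   F(m) = [m = 0] + Σ_{c=1}^{m} w(c) F(m-c),
-- which determines F; the closed form F(0) = 1, F(m) = (-1)^m b_m satisfies it.
module Submission where

open import Defs
open import Data.Nat using (ℕ; _≤_)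
open import Data.List using (map; length)
open import Data.Integer using (ℤ; +_; _*_)
open import Relation.Binary.PropositionalEquality using (_≡_)

open import Data.Nat as ℕ using (zero; suc; _+_; _∸_; _<_; _≤?_)
open import Data.Nat.Properties
  using (_≟_; +-assoc; +-suc; m≤m+n; m+n∸m≡n; m+[n∸m]≡n; ≤-refl; ≤-trans; ≤-reflexive;
         n≤1+n; <-irrefl; <-trans; <-≤-trans; ≤-<-trans; +-monoʳ-≤; +-monoʳ-<; m<m+n; n<1+n;
         m∸n≤m; ∸-monoʳ-<)
open import Data.Nat.ListAction using (sum)
open import Data.Integer as ℤ using (0ℤ; 1ℤ; -_)
import Data.Integer.Properties as ℤP
open import Data.Integer.Tactic.RingSolver using (solve-∀)
open import Data.Fin using (toℕ)
open import Data.Fin.Properties using (toℕ<n)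
open import Data.List using (List; []; _∷_; [_]; _++_; concatMap; filter; reverse; upTo; applyUpTo)
open import Data.List.Properties
  using (upTo-∷ʳ; map-upTo; map-++; reverse-++; ++-identityʳ; filter-++; filter-all; filter-none;
         map-∘; map-cong)
open import Data.List.Relation.Unary.All as All using (All; []; _∷_)
open import Data.List.Relation.Unary.All.Properties using (++⁺)
open import Data.Product using (_×_; _,_; proj₁; proj₂)
open import Function using (_∘_; id)
open import Relation.Nullary using (Dec; yes; no; ¬_)
open import Relation.Binary.PropositionalEquality using (refl; sym; trans; cong; cong₂; module ≡-Reasoning)
open import Algebra.Properties.Semiring.Sum ℤP.+-*-semiring
  using (∑-comm; *-distribˡ-sum; sum-cong-≗; sum-replicate-zero)
  renaming (sum to ∑)

open ≡-Reasoning

signPow-+ : ∀ a b → signPow (a + b) ≡ signPow a * signPow b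
signPow-+ zero    b = sym (ℤP.*-identityˡ (signPow b))
signPow-+ (suc a) b = trans (cong -_ (signPow-+ a b)) (ℤP.neg-distribˡ-* (signPow a) (signPow b))

signPow-double : ∀ a → signPow (a + a) ≡ 1ℤ
signPow-double zero    = refl
signPow-double (suc a) = begin
  - signPow (a + suc a)      ≡⟨ cong (λ t → - signPow t) (+-suc a a) ⟩
  - - signPow (a + a)        ≡⟨ ℤP.neg-involutive (signPow (a + a)) ⟩
  signPow (a + a)            ≡⟨ signPow-double a ⟩
  1ℤ                         ∎

-- triangle c = c(c-1)/2, the number of inversions of a decreasing word of length c.
triangle : ℕ → ℕ
triangle zero    = 0
triangle (suc c) = c + triangle c

decBlock-suc : ∀ s c → decBlock s (suc c) ≡ s + suc c ∷ decBlock s c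
decBlock-suc s c = begin
  reverse (map (_+_ s) (map suc (upTo (suc c))))
    ≡⟨ cong (λ xs → reverse (map (_+_ s) (map suc xs))) (sym (upTo-∷ʳ c)) ⟩
  reverse (map (_+_ s) (map suc (upTo c ++ [ c ])))
    ≡⟨ cong (reverse ∘ map (_+_ s)) (map-++ suc (upTo c) [ c ]) ⟩
  reverse (map (_+_ s) (oneTo c ++ [ suc c ]))
    ≡⟨ cong reverse (map-++ (_+_ s) (oneTo c) [ suc c ]) ⟩
  reverse (map (_+_ s) (oneTo c) ++ [ s + suc c ])
    ≡⟨ reverse-++ (map (_+_ s) (oneTo c)) [ s + suc c ] ⟩
  s + suc c ∷ decBlock s c
    ∎

decBlock-bounds : ∀ s c → All (λ y → s < y × y ≤ s + c) (decBlock s c)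
decBlock-bounds s zero    = []
decBlock-bounds s (suc c) rewrite decBlock-suc s c =
  (m<m+n s (ℕ.s≤s ℕ.z≤n) , ≤-refl)
    ∷ All.map (λ (s<y , y≤s+c) → s<y , ≤-trans y≤s+c (+-monoʳ-≤ s (n≤1+n c))) (decBlock-bounds s c)

decBlock-length : ∀ s c → length (decBlock s c) ≡ c
decBlock-length s zero    = refl
decBlock-length s (suc c) rewrite decBlock-suc s c = cong suc (decBlock-length s c)

below : ℕ → List ℕ → ℕ
below x ys = length (filter (ℕ._<? x) ys)

decBlock-inversions : ∀ s c → inversions (decBlock s c) ≡ triangle c
decBlock-inversions s zero    = refl
decBlock-inversions s (suc c) rewrite decBlock-suc s c =
  cong₂ _+_ allBelow (decBlock-inversions s c)
  where
  allBelow : below (s + suc c) (decBlock s c) ≡ c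
  allBelow = begin
    length (filter (ℕ._<? s + suc c) (decBlock s c))
      ≡⟨ cong length (filter-all (ℕ._<? s + suc c)
           (All.map (λ (_ , y≤s+c) → ≤-<-trans y≤s+c (+-monoʳ-< s (n<1+n c))) (decBlock-bounds s c))) ⟩
    length (decBlock s c)
      ≡⟨ decBlock-length s c ⟩
    c ∎

inversions-++ : ∀ B xs ys → All (_≤ B) xs → All (B <_) ys →
                inversions (xs ++ ys) ≡ inversions xs + inversions ys
inversions-++ B []       ys []             _    = refl
inversions-++ B (x ∷ xs) ys (x≤B ∷ xs≤B) B<ys = begin
  below x (xs ++ ys) + inversions (xs ++ ys)
    ≡⟨ cong₂ _+_ belowPrefix (inversions-++ B xs ys xs≤B B<ys) ⟩
  below x xs + (inversions xs + inversions ys)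
    ≡⟨ sym (+-assoc (below x xs) (inversions xs) (inversions ys)) ⟩
  below x xs + inversions xs + inversions ys
    ∎
  where
  noneBelow : filter (ℕ._<? x) ys ≡ []
  noneBelow = filter-none (ℕ._<? x)
    (All.map (λ B<y y<x → <-irrefl refl (<-trans B<y (<-≤-trans y<x x≤B))) B<ys)
  belowPrefix : below x (xs ++ ys) ≡ below x xs
  belowPrefix = begin
    length (filter (ℕ._<? x) (xs ++ ys))
      ≡⟨ cong length (filter-++ (ℕ._<? x) xs ys) ⟩
    length (filter (ℕ._<? x) xs ++ filter (ℕ._<? x) ys)
      ≡⟨ cong (λ zs → length (filter (ℕ._<? x) xs ++ zs)) noneBelow ⟩
    length (filter (ℕ._<? x) xs ++ [])
      ≡⟨ cong length (++-identityʳ (filter (ℕ._<? x) xs)) ⟩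
    below x xs ∎

gAux-above : ∀ s cs → All (s <_) (gAux s cs)
gAux-above s []       = []
gAux-above s (c ∷ cs) =
  ++⁺ (All.map proj₁ (decBlock-bounds s c))
      (All.map (≤-<-trans (m≤m+n s c)) (gAux-above (s + c) cs))

gAux-inversions : ∀ s cs → inversions (gAux s cs) ≡ sum (map triangle cs)
gAux-inversions s []       = refl
gAux-inversions s (c ∷ cs) = begin
  inversions (decBlock s c ++ gAux (s + c) cs)
    ≡⟨ inversions-++ (s + c) (decBlock s c) (gAux (s + c) cs)
         (All.map proj₂ (decBlock-bounds s c)) (gAux-above (s + c) cs) ⟩
  inversions (decBlock s c) + inversions (gAux (s + c) cs)
    ≡⟨ cong₂ _+_ (decBlock-inversions s c) (gAux-inversions (s + c) cs) ⟩
  triangle c + sum (map triangle cs)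
    ∎

weight : List ℕ → ℤ
weight σ = signPow (length σ) * sign (g σ)

partWeight : ℕ → ℤ
partWeight c = - signPow (triangle c)

-- Prepending a part multiplies the weight by that part's weight: the new block
-- adds triangle c inversions and one to the length.
weight-∷ : ∀ c σ → weight (c ∷ σ) ≡ partWeight c * weight σ
weight-∷ c σ = begin
  - signPow (length σ) * signPow (inversions (g (c ∷ σ)))
    ≡⟨ cong (λ t → - signPow (length σ) * signPow t) (gAux-inversions 0 (c ∷ σ)) ⟩
  - signPow (length σ) * signPow (triangle c + T)
    ≡⟨ cong (- signPow (length σ) *_) (signPow-+ (triangle c) T) ⟩
  - signPow (length σ) * (signPow (triangle c) * signPow T)
    ≡⟨ exchange (signPow (length σ)) (signPow (triangle c)) (signPow T) ⟩
  partWeight c * (signPow (length σ) * signPow T)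
    ≡⟨ cong (λ t → partWeight c * (signPow (length σ) * signPow t)) (sym (gAux-inversions 0 σ)) ⟩
  partWeight c * weight σ
    ∎
  where
  T = sum (map triangle σ)
  exchange : ∀ a b c → (- a) * (b * c) ≡ (- b) * (a * c)
  exchange = solve-∀

-- w(c+2) = -w(c), since triangle (c+2) = triangle c + (2c + 1) and 2c + 1 is odd.
partWeight-+2 : ∀ c → partWeight (suc (suc c)) ≡ - partWeight c
partWeight-+2 c = cong -_ (begin
  signPow (suc c + (c + triangle c))
    ≡⟨ cong (signPow ∘ suc) (sym (+-assoc c c (triangle c))) ⟩
  - signPow (c + c + triangle c)
    ≡⟨ cong -_ (signPow-+ (c + c) (triangle c)) ⟩
  - (signPow (c + c) * signPow (triangle c))
    ≡⟨ cong (λ t → - (t * signPow (triangle c))) (signPow-double c) ⟩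
  - (1ℤ * signPow (triangle c))
    ≡⟨ cong -_ (ℤP.*-identityˡ (signPow (triangle c))) ⟩
  partWeight c
    ∎)

Σ : {A : Set} → List A → (A → ℤ) → ℤ
Σ L h = sumℤ (map h L)

Σ-cong : {A : Set} (L : List A) {h h′ : A → ℤ} → (∀ x → h x ≡ h′ x) → Σ L h ≡ Σ L h′
Σ-cong L h≗h′ = cong sumℤ (map-cong h≗h′ L)

Σ-map : {A B : Set} (f : A → B) (L : List A) (h : B → ℤ) → Σ (map f L) h ≡ Σ L (h ∘ f)
Σ-map f L h = cong sumℤ (sym (map-∘ L))

Σ-++ : {A : Set} (L₁ L₂ : List A) (h : A → ℤ) → Σ (L₁ ++ L₂) h ≡ Σ L₁ h ℤ.+ Σ L₂ h
Σ-++ []       L₂ h = sym (ℤP.+-identityˡ (Σ L₂ h))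
Σ-++ (x ∷ L₁) L₂ h =
  trans (cong (ℤ._+_ (h x)) (Σ-++ L₁ L₂ h)) (sym (ℤP.+-assoc (h x) (Σ L₁ h) (Σ L₂ h)))

Σ-concatMap : {A B : Set} (F : A → List B) (L : List A) (h : B → ℤ) →
              Σ (concatMap F L) h ≡ Σ L (λ y → Σ (F y) h)
Σ-concatMap F []      h = refl
Σ-concatMap F (y ∷ L) h =
  trans (Σ-++ (F y) (concatMap F L) h) (cong (ℤ._+_ (Σ (F y) h)) (Σ-concatMap F L h))

Σ-scale : {A : Set} (L : List A) (c : ℤ) (h : A → ℤ) → Σ L (λ x → c * h x) ≡ c * Σ L h
Σ-scale []      c h = sym (ℤP.*-zeroʳ c)
Σ-scale (x ∷ L) c h =
  trans (cong (ℤ._+_ (c * h x)) (Σ-scale L c h)) (sym (ℤP.*-distribˡ-+ c (h x) (Σ L h)))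

Σ-zero : {A : Set} (L : List A) → Σ L (λ _ → 0ℤ) ≡ 0ℤ
Σ-zero []      = refl
Σ-zero (x ∷ L) = trans (ℤP.+-identityˡ (Σ L (λ _ → 0ℤ))) (Σ-zero L)

indicator : {P : Set} → Dec P → ℤ → ℤ
indicator (yes _) v = v
indicator (no _)  v = 0ℤ

indicator-⇔ : {P Q : Set} (p : Dec P) (q : Dec Q) {v : ℤ} →
              (P → Q) → (Q → P) → indicator p v ≡ indicator q v
indicator-⇔ (yes _) (yes _) P→Q Q→P = refl
indicator-⇔ (yes p) (no ¬q) P→Q Q→P with () ← ¬q (P→Q p)
indicator-⇔ (no ¬p) (yes q) P→Q Q→P with () ← ¬p (Q→P q)
indicator-⇔ (no _)  (no _)  P→Q Q→P = refl

indicator-accept : {P : Set} (p : Dec P) {v : ℤ} → P → indicator p v ≡ v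
indicator-accept (yes _) _ = refl
indicator-accept (no ¬p) p with () ← ¬p p

indicator-reject : {P : Set} (p : Dec P) {v : ℤ} → ¬ P → indicator p v ≡ 0ℤ
indicator-reject (yes p) ¬p with () ← ¬p p
indicator-reject (no _)  ¬p = refl

indicator-scale : {P : Set} (p : Dec P) (c v : ℤ) → c * indicator p v ≡ indicator p (c * v)
indicator-scale (yes _) c v = refl
indicator-scale (no _)  c v = ℤP.*-zeroʳ c

Σ-indicator : {A : Set} {P : Set} (p : Dec P) (L : List A) (h : A → ℤ) →
              Σ L (λ x → indicator p (h x)) ≡ indicator p (Σ L h)
Σ-indicator (yes _) L h = refl
Σ-indicator (no _)  L h = Σ-zero L

Σ-filter : {A : Set} {P : A → Set} (P? : (x : A) → Dec (P x)) (L : List A) (h : A → ℤ) →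
           Σ (filter P? L) h ≡ Σ L (λ x → indicator (P? x) (h x))
Σ-filter P? []      h = refl
Σ-filter P? (x ∷ L) h with P? x
... | yes _ = cong (ℤ._+_ (h x)) (Σ-filter P? L h)
... | no _  = trans (Σ-filter P? L h) (sym (ℤP.+-identityˡ _))

indicator-split : ∀ x s m (v : ℤ) →
                  indicator (x + s ≟ m) v ≡ indicator (x ≤? m) (indicator (s ≟ m ∸ x) v)
indicator-split x s m v with x ≤? m
... | yes x≤m = indicator-⇔ (x + s ≟ m) (s ≟ m ∸ x)
                  (λ x+s≡m → trans (sym (m+n∸m≡n x s)) (cong (_∸ x) x+s≡m))
                  (λ s≡m∸x → trans (cong (_+_ x) s≡m∸x) (m+[n∸m]≡n x≤m))
... | no x≰m  = indicator-reject (x + s ≟ m)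
                  (λ x+s≡m → x≰m (≤-trans (m≤m+n x s) (≤-reflexive x+s≡m)))

sumBelow : ℕ → (ℕ → ℤ) → ℤ
sumBelow n h = ∑ {n} (λ i → h (toℕ i))

Σ-applyUpTo : (f : ℕ → ℕ) (N : ℕ) (h : ℕ → ℤ) → Σ (applyUpTo f N) h ≡ sumBelow N (h ∘ f)
Σ-applyUpTo f zero    h = refl
Σ-applyUpTo f (suc N) h = cong (ℤ._+_ (h (f 0))) (Σ-applyUpTo (f ∘ suc) N h)

sumBelow-cong : ∀ n {h h′ : ℕ → ℤ} → (∀ i → i < n → h i ≡ h′ i) → sumBelow n h ≡ sumBelow n h′
sumBelow-cong n h≗h′ = sum-cong-≗ {n} (λ i → h≗h′ (toℕ i) (toℕ<n i))

sumBelow-zero : ∀ n (h : ℕ → ℤ) → (∀ i → h i ≡ 0ℤ) → sumBelow n h ≡ 0ℤ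
sumBelow-zero n h h≡0 = trans (sum-cong-≗ {n} (h≡0 ∘ toℕ)) (sum-replicate-zero n)

sumBelow-neg : ∀ n (h : ℕ → ℤ) → sumBelow n (λ i → - h i) ≡ - sumBelow n h
sumBelow-neg n h = begin
  sumBelow n (λ i → - h i)          ≡⟨ sumBelow-cong n (λ i _ → sym (ℤP.-1*i≡-i (h i))) ⟩
  sumBelow n (λ i → ℤ.-1ℤ * h i)    ≡⟨ sym (*-distribˡ-sum {n} ℤ.-1ℤ (h ∘ toℕ)) ⟩
  ℤ.-1ℤ * sumBelow n h              ≡⟨ ℤP.-1*i≡-i (sumBelow n h) ⟩
  - sumBelow n h                    ∎

sumBelow-truncate : ∀ m n (h : ℕ → ℤ) → m ≤ n → (∀ i → m ≤ i → h i ≡ 0ℤ) →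
                    sumBelow n h ≡ sumBelow m h
sumBelow-truncate zero    n       h _         h≡0 = sumBelow-zero n h (λ i → h≡0 i ℕ.z≤n)
sumBelow-truncate (suc m) (suc n) h (ℕ.s≤s m≤n) h≡0 =
  cong (ℤ._+_ (h 0)) (sumBelow-truncate m n (h ∘ suc) m≤n (λ i m≤i → h≡0 (suc i) (ℕ.s≤s m≤i)))

Σ-oneTo-restrict : ∀ m n (h : ℕ → ℤ) → m ≤ n →
                   Σ (oneTo n) (λ x → indicator (x ≤? m) (h x)) ≡ sumBelow m (h ∘ suc)
Σ-oneTo-restrict m n h m≤n = begin
  Σ (oneTo n) H                       ≡⟨ cong (λ xs → Σ xs H) (map-upTo suc n) ⟩
  Σ (applyUpTo suc n) H               ≡⟨ Σ-applyUpTo suc n H ⟩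
  sumBelow n (H ∘ suc)                ≡⟨ sumBelow-truncate m n (H ∘ suc) m≤n beyond ⟩
  sumBelow m (H ∘ suc)                ≡⟨ sumBelow-cong m within ⟩
  sumBelow m (h ∘ suc)                ∎
  where
  H : ℕ → ℤ
  H x = indicator (x ≤? m) (h x)
  beyond : ∀ i → m ≤ i → H (suc i) ≡ 0ℤ
  beyond i m≤i = indicator-reject (suc i ≤? m) (λ i<m → <-irrefl refl (<-≤-trans i<m m≤i))
  within : ∀ i → i < m → H (suc i) ≡ h (suc i)
  within i i<m = indicator-accept (suc i ≤? m) i<m

wordWeight : ℕ → ℕ → ℕ → ℤ
wordWeight n k m = Σ (listsOf (oneTo n) k) (λ l → indicator (sum l ≟ m) (weight l))

wordWeight-zero : ∀ n m → wordWeight n 0 m ≡ indicator (0 ≟ m) 1ℤ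
wordWeight-zero n m = ℤP.+-identityʳ (indicator (0 ≟ m) 1ℤ)

wordWeight-firstLetter : ∀ n k m →
  wordWeight n (suc k) m ≡ Σ (oneTo n) (λ x → indicator (x ≤? m) (partWeight x * wordWeight n k (m ∸ x)))
wordWeight-firstLetter n k m = begin
  Σ (concatMap (λ x → map (x ∷_) L) (oneTo n)) H
    ≡⟨ Σ-concatMap (λ x → map (x ∷_) L) (oneTo n) H ⟩
  Σ (oneTo n) (λ x → Σ (map (x ∷_) L) H)
    ≡⟨ Σ-cong (oneTo n) (λ x → Σ-map (x ∷_) L H) ⟩
  Σ (oneTo n) (λ x → Σ L (λ l → H (x ∷ l)))
    ≡⟨ Σ-cong (oneTo n) (λ x → Σ-cong L (prepend x)) ⟩
  Σ (oneTo n) (λ x → Σ L (λ l → indicator (x ≤? m) (partWeight x * rest x l)))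
    ≡⟨ Σ-cong (oneTo n) (λ x → Σ-indicator (x ≤? m) L (λ l → partWeight x * rest x l)) ⟩
  Σ (oneTo n) (λ x → indicator (x ≤? m) (Σ L (λ l → partWeight x * rest x l)))
    ≡⟨ Σ-cong (oneTo n) (λ x → cong (indicator (x ≤? m)) (Σ-scale L (partWeight x) (rest x))) ⟩
  Σ (oneTo n) (λ x → indicator (x ≤? m) (partWeight x * wordWeight n k (m ∸ x)))
    ∎
  where
  L = listsOf (oneTo n) k
  H : List ℕ → ℤ
  H l = indicator (sum l ≟ m) (weight l)
  rest : ℕ → List ℕ → ℤ
  rest x l = indicator (sum l ≟ m ∸ x) (weight l)
  prepend : ∀ x l → H (x ∷ l) ≡ indicator (x ≤? m) (partWeight x * rest x l)
  prepend x l = begin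
    indicator (x + sum l ≟ m) (weight (x ∷ l))
      ≡⟨ cong (indicator (x + sum l ≟ m)) (weight-∷ x l) ⟩
    indicator (x + sum l ≟ m) (partWeight x * weight l)
      ≡⟨ indicator-split x (sum l) m (partWeight x * weight l) ⟩
    indicator (x ≤? m) (indicator (sum l ≟ m ∸ x) (partWeight x * weight l))
      ≡⟨ cong (indicator (x ≤? m)) (sym (indicator-scale (sum l ≟ m ∸ x) (partWeight x) (weight l))) ⟩
    indicator (x ≤? m) (partWeight x * rest x l)
      ∎

wordWeight-suc : ∀ n k m → m ≤ n →
  wordWeight n (suc k) m ≡ sumBelow m (λ i → partWeight (suc i) * wordWeight n k (m ∸ suc i))
wordWeight-suc n k m m≤n =
  trans (wordWeight-firstLetter n k m)
        (Σ-oneTo-restrict m n (λ x → partWeight x * wordWeight n k (m ∸ x)) m≤n)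

closedForm : ℕ → ℤ
closedForm zero    = 1ℤ
closedForm (suc k) = signPow (suc k) * + b (suc k)

-- Σ_{c=1}^{m} w(c) F(m-c) = F(m) for m = j + 1 ≥ 1. For m ≥ 3 the terms with
-- c ≥ 3 are, by w(c+2) = -w(c), the negated sum for m - 2, i.e. -F(m-2); this
-- cancels the term w(2) F(m-2) = F(m-2), leaving w(1) F(m-1) = -F(m-1) = F(m)
-- because b_{m-1} = b_m = 2.
closedForm-convolution : ∀ j →
  sumBelow (suc j) (λ i → partWeight (suc i) * closedForm (j ∸ i)) ≡ closedForm (suc j)
closedForm-convolution zero          = refl
closedForm-convolution (suc zero)    = refl
closedForm-convolution (suc (suc j)) = begin
  partWeight 1 * closedForm (suc (suc j)) ℤ.+ (partWeight 2 * closedForm (suc j) ℤ.+ tail)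
    ≡⟨ cong₂ ℤ._+_ (ℤP.-1*i≡-i (closedForm (suc (suc j))))
                  (cong₂ ℤ._+_ (ℤP.*-identityˡ (closedForm (suc j))) tail≡) ⟩
  - closedForm (suc (suc j)) ℤ.+ (closedForm (suc j) ℤ.+ - closedForm (suc j))
    ≡⟨ cong (ℤ._+_ (- closedForm (suc (suc j)))) (ℤP.+-inverseʳ (closedForm (suc j))) ⟩
  - closedForm (suc (suc j)) ℤ.+ 0ℤ
    ≡⟨ ℤP.+-identityʳ (- closedForm (suc (suc j))) ⟩
  - (signPow (suc (suc j)) * + 2)
    ≡⟨ ℤP.neg-distribˡ-* (signPow (suc (suc j))) (+ 2) ⟩
  closedForm (suc (suc (suc j)))
    ∎
  where
  tail : ℤ
  tail = sumBelow (suc j) (λ i → partWeight (suc (suc (suc i))) * closedForm (j ∸ i))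
  tail≡ : tail ≡ - closedForm (suc j)
  tail≡ = begin
    tail
      ≡⟨ sumBelow-cong (suc j) (λ i _ → trans (cong (_* closedForm (j ∸ i)) (partWeight-+2 (suc i)))
                                              (sym (ℤP.neg-distribˡ-* (partWeight (suc i)) (closedForm (j ∸ i))))) ⟩
    sumBelow (suc j) (λ i → - (partWeight (suc i) * closedForm (j ∸ i)))
      ≡⟨ sumBelow-neg (suc j) (λ i → partWeight (suc i) * closedForm (j ∸ i)) ⟩
    - sumBelow (suc j) (λ i → partWeight (suc i) * closedForm (j ∸ i))
      ≡⟨ cong -_ (closedForm-convolution j) ⟩
    - closedForm (suc j)
      ∎

closedForm-recurrence : ∀ m →
  indicator (0 ≟ m) 1ℤ ℤ.+ sumBelow m (λ i → partWeight (suc i) * closedForm (m ∸ suc i))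
    ≡ closedForm m
closedForm-recurrence zero    = refl
closedForm-recurrence (suc j) = trans (ℤP.+-identityˡ _) (closedForm-convolution j)

wordWeight-total : ∀ n N m → m ≤ n → m < N →
                   sumBelow N (λ k → wordWeight n k m) ≡ closedForm m
wordWeight-total n (suc N) m m≤n (ℕ.s≤s m≤N) = begin
  wordWeight n 0 m ℤ.+ sumBelow N (λ k → wordWeight n (suc k) m)
    ≡⟨ cong₂ ℤ._+_ (wordWeight-zero n m) (sumBelow-cong N (λ k _ → wordWeight-suc n k m m≤n)) ⟩
  δ ℤ.+ sumBelow N (λ k → sumBelow m (λ i → term k i))
    ≡⟨ cong (ℤ._+_ δ) (∑-comm {N} {m} (λ k i → term (toℕ k) (toℕ i))) ⟩
  δ ℤ.+ sumBelow m (λ i → sumBelow N (λ k → term k i))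
    ≡⟨ cong (ℤ._+_ δ) (sumBelow-cong m shorter) ⟩
  δ ℤ.+ sumBelow m (λ i → partWeight (suc i) * closedForm (m ∸ suc i))
    ≡⟨ closedForm-recurrence m ⟩
  closedForm m
    ∎
  where
  δ = indicator (0 ≟ m) 1ℤ
  term : ℕ → ℕ → ℤ
  term k i = partWeight (suc i) * wordWeight n k (m ∸ suc i)
  -- the remaining letter sum m - (i+1) is smaller, so the induction hypothesis applies
  shorter : ∀ i → i < m → sumBelow N (λ k → term k i) ≡ partWeight (suc i) * closedForm (m ∸ suc i)
  shorter i i<m = begin
    sumBelow N (λ k → term k i)
      ≡⟨ sym (*-distribˡ-sum {N} (partWeight (suc i)) (λ k → wordWeight n (toℕ k) (m ∸ suc i))) ⟩
    partWeight (suc i) * sumBelow N (λ k → wordWeight n k (m ∸ suc i))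
      ≡⟨ cong (partWeight (suc i) *_) (wordWeight-total n N (m ∸ suc i) m-i-1≤n m-i-1<N) ⟩
    partWeight (suc i) * closedForm (m ∸ suc i)
      ∎
    where
    m-i-1≤n = ≤-trans (m∸n≤m m (suc i)) m≤n
    m-i-1<N = <-≤-trans (∸-monoʳ-< {m} {suc i} {0} (ℕ.s≤s ℕ.z≤n) i<m) m≤N

mainTheorem14 : (n : ℕ) → 1 ≤ n →
    sumℤ (map (λ σ → signPow (length σ) * sign (g σ)) (compositions n)) ≡ signPow n * (+ b n)
mainTheorem14 (suc n) _ = begin
  Σ (compositions (suc n)) weight
    ≡⟨ Σ-filter (λ cs → sum cs ≟ suc n) (concatMap (listsOf (oneTo (suc n))) lengths) weight ⟩
  Σ (concatMap (listsOf (oneTo (suc n))) lengths) (λ l → indicator (sum l ≟ suc n) (weight l))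
    ≡⟨ Σ-concatMap (listsOf (oneTo (suc n))) lengths (λ l → indicator (sum l ≟ suc n) (weight l)) ⟩
  Σ lengths (λ k → wordWeight (suc n) k (suc n))
    ≡⟨ Σ-applyUpTo id (suc (suc n)) (λ k → wordWeight (suc n) k (suc n)) ⟩
  sumBelow (suc (suc n)) (λ k → wordWeight (suc n) k (suc n))
    ≡⟨ wordWeight-total (suc n) (suc (suc n)) (suc n) ≤-refl ≤-refl ⟩
  closedForm (suc n)
    ∎
  where
  lengths = upTo (suc (suc n))
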